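{- Let $H$ be a connected, square-free graph with at least two even-degree vertices. Then $H$ has a hardness gadget $(i,s,(J_1,y),(J_2,z),(J_3,y,z))$. Furthermore, $J_1$, $J_2$ and $J_3$ can be chosen so that each contains at least one pinned vertex.
   Context: Graphs are finite, simple, undirected, loopless; square-free means no 4-cycle as a subgraph. A partially $H$-labelled graph $J=(G,\tau)$ is a graph $G$ with a partial function $\tau:V(G)\to V(H)$; vertices in $\mathrm{dom}(\tau)$ are pinned; $J$ is connected if $G$ is. A homomorphism from $J$ to $H$ is a graph homomorphism $\sigma:G\to H$ with $\sigma(v)=\tau(v)$ on $\mathrm{dom}(\tau)$; $\mathrm{Hom}((J,y),(H,a))$ denotes those also mapping the distinguished vertex $y$ to $a$, and $\mathrm{Hom}((J,y,z),(H,a,b))$ those mapping $y\mapsto a$, $z\mapsto b$. A hardness gadget for $H$ is a tuple $(i,s,(J_1,y),(J_2,z),(J_3,y,z))$ with $i,s\in V(H)$ and $J_1,J_2,J_3$ connected partially $H$-labelled graphs with distinguished vertices $y$ in $J_1$, $z$ in $J_2$, and $y,z$ in $J_3$, such that, with $\Omega_y=\{a: |\mathrm{Hom}((J_1,y),(H,a))|\text{ odd}\}$, $\Omega_z=\{b:|\mathrm{Hom}((J_2,z),(H,b))|\text{ odd}\}$, $\Sigma_{a,b}=\mathrm{Hom}((J_3,y,z),(H,a,b))$: (1) $|\Omega_y|$ even and $i\in\Omega_y$; (2) $|\Omega_z|$ even and $s\in\Omega_z$; (3) $|\Sigma_{o,x}|$ even for all $o\in\Omega_y\setminus\{i\}$,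 $x\in\Omega_z\setminus\{s\}$; (4) $|\Sigma_{i,s}|$ odd and $|\Sigma_{o,s}|,|\Sigma_{i,x}|$ odd for all such $o,x$. -}

module Defs where

open import Data.Nat using (ℕ; zero; suc; _%_)
open import Data.Bool using (Bool; true; false; T)
open import Data.Fin using (Fin; zero; suc; _≟_)
open import Data.Fin.Properties using (all?)
open import Data.List using (List; []; _∷_; [_]; map; concatMap; filter; length; allFin)
open import Data.Maybe using (Maybe; just; nothing)
open import Data.Product using (Σ; _×_; _,_; ∃)
open import Relation.Nullary using (¬_; Dec; yes; no)
open import Relation.Nullary.Decidable using (_×-dec_; _→-dec_; ¬?)
open import Relation.Binary.PropositionalEquality using (_≡_)
open import Data.Bool.Properties using () renaming (_≟_ to _≟ᵇ_)

record Graph : Set where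
  field
    n      : ℕ
    adj    : Fin n → Fin n → Bool
    sym    : ∀ u v → adj u v ≡ adj v u
    irrefl : ∀ v → adj v v ≡ false

open Graph public

Adj : (G : Graph) → Fin (n G) → Fin (n G) → Set
Adj G u v = T (adj G u v)

data Walk (G : Graph) : Fin (n G) → Fin (n G) → Set where
  here : ∀ {u} → Walk G u u
  step : ∀ {u v w} → Adj G u v → Walk G v w → Walk G u w

Connected : Graph → Set
Connected G = ∀ u v → Walk G u v

SquareFree : Graph → Set
SquareFree G = ∀ (a b c d : Fin (n G)) →
  ¬ ( ¬ a ≡ b × ¬ a ≡ c × ¬ a ≡ d × ¬ b ≡ c × ¬ b ≡ d × ¬ c ≡ d
    × Adj G a b × Adj G b c × Adj G c d × Adj G d a )

countFin : ∀ {m} {P : Fin m → Set} → (∀ x → Dec (P x)) → ℕ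
countFin {m} P? = length (filter P? (allFin m))

degree : (G : Graph) → Fin (n G) → ℕ
degree G u = countFin (λ v → adj G u v ≟ᵇ true)

Even Odd : ℕ → Set
Even k = k % 2 ≡ 0
Odd  k = k % 2 ≡ 1

TwoEvenDegree : Graph → Set
TwoEvenDegree G = Σ (Fin (n G)) λ u → Σ (Fin (n G)) λ v →
  ¬ u ≡ v × Even (degree G u) × Even (degree G v)

record PLGraph (H : Graph) : Set where
  field
    G   : Graph
    τ   : Fin (n G) → Maybe (Fin (n H))

open PLGraph public

ConnectedPL : ∀ {H} → PLGraph H → Set
ConnectedPL J = Connected (G J)

HasPinned : ∀ {H} → PLGraph H → Set
HasPinned {H} J = Σ (Fin (n (G J))) λ v → Σ (Fin (n H)) λ a → τ J v ≡ just a

IsHom : ∀ {H} (J : PLGraph H) → (Fin (n (G J)) → Fin (n H)) → Set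
IsHom {H} J σ =
  (∀ u v → Adj (G J) u v → Adj H (σ u) (σ v)) ×
  (∀ v a → τ J v ≡ just a → σ v ≡ a)

allFuns : ∀ m k → List (Fin m → Fin k)
allFuns zero    k = [ (λ ()) ]
allFuns (suc m) k = concatMap (λ f → map (λ a → cons a f) (allFin k)) (allFuns m k)
  where
  cons : Fin k → (Fin m → Fin k) → Fin (suc m) → Fin k
  cons a f zero    = a
  cons a f (suc i) = f i

isHom? : ∀ {H} (J : PLGraph H) σ → Dec (IsHom J σ)
isHom? {H} J σ =
  all? (λ u → all? (λ v → (adj (G J) u v ≟ᵇ true) →-dec' (adj H (σ u) (σ v) ≟ᵇ true)))
  ×-dec all? (λ v → all? (λ a → (τ J v ≟ₘ just a) →-dec (σ v ≟ a)))
  where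
  _→-dec'_ : ∀ {b c : Bool} → Dec (b ≡ true) → Dec (c ≡ true) → Dec (T b → T c)
  _→-dec'_ {true}  {c} _ _ with c
  ... | true  = yes (λ x → x)
  ... | false = no (λ f → f _)
  _→-dec'_ {false} {c} _ _ = yes (λ ())
  _≟ₘ_ : (x y : Maybe (Fin (n H))) → Dec (x ≡ y)
  _≟ₘ_ = Data.Maybe.Properties.≡-dec _≟_
    where import Data.Maybe.Properties

homCount1 : ∀ {H} (J : PLGraph H) → Fin (n (G J)) → Fin (n H) → ℕ
homCount1 {H} J y a =
  length (filter (λ σ → isHom? J σ ×-dec (σ y ≟ a)) (allFuns (n (G J)) (n H)))

homCount2 : ∀ {H} (J : PLGraph H) → Fin (n (G J)) → Fin (n (G J)) →
            Fin (n H) → Fin (n H) → ℕ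
homCount2 {H} J y z a b =
  length (filter (λ σ → isHom? J σ ×-dec (σ y ≟ a) ×-dec (σ z ≟ b))
                 (allFuns (n (G J)) (n H)))

Ω : ∀ {H} (J : PLGraph H) → Fin (n (G J)) → Fin (n H) → Set
Ω J y a = Odd (homCount1 J y a)

ΩSize : ∀ {H} (J : PLGraph H) → Fin (n (G J)) → ℕ
ΩSize {H} J y = countFin (λ a → homCount1 J y a % 2 Data.Nat.≟ 1)
  where import Data.Nat

-- (i,s,(J1,y),(J2,z),(J3,y',z')) is a hardness gadget for H
-- (y', z' are the distinguished vertices y, z of J3)
IsHardnessGadget : (H : Graph) (i s : Fin (n H))
  (J₁ : PLGraph H) (y : Fin (n (G J₁)))
  (J₂ : PLGraph H) (z : Fin (n (G J₂)))
  (J₃ : PLGraph H) (y' z' : Fin (n (G J₃))) → Set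
IsHardnessGadget H i s J₁ y J₂ z J₃ y' z' =
  ConnectedPL J₁ × ConnectedPL J₂ × ConnectedPL J₃ ×
  (Even (ΩSize J₁ y) × Ω J₁ y i) ×
  (Even (ΩSize J₂ z) × Ω J₂ z s) ×
  (∀ o x → Ω J₁ y o → ¬ o ≡ i → Ω J₂ z x → ¬ x ≡ s →
     Even (homCount2 J₃ y' z' o x)) ×
  Odd (homCount2 J₃ y' z' i s) ×
  (∀ o → Ω J₁ y o → ¬ o ≡ i → Odd (homCount2 J₃ y' z' o s)) ×
  (∀ x → Ω J₂ z x → ¬ x ≡ s → Odd (homCount2 J₃ y' z' i x))

-- Let u ≠ v have even degree. Reducing a walk from u to v to a non-backtracking one and
-- cutting it at the first even-degree vertex after u gives a non-backtracking path
-- p₀ = u, p₁, …, p_{d+1} whose interior vertices have odd degree and whose ends have even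
-- degree. J₁ and J₂ are an edge with a leg pinned to p₀ resp. p_{d+1}, so Ω_y = N(p₀) and
-- Ω_z = N(p_{d+1}) have even size. J₃ is a caterpillar: a spine y = w₀, …, w_{d+1} = z with a
-- leg at wⱼ pinned to pⱼ, so Σ_{o,x} counts the walks o = w₀, …, w_{d+1} = x with wⱼ ∈ N(pⱼ).
-- Take i = p₁ and s = p_d. Square-freeness forces such a walk starting at o ∈ N(p₀) ∖ {p₁} to
-- be o, p₀, …, p_d, so Σ_{o,x} is odd iff x = p_d. A walk starting at p₁ may instead step to
-- any a ∈ N(p₁) ∖ {p₂} and is then forced as before; since deg p₁, …, deg p_d are odd,
-- induction along the path shows that Σ_{p₁,x} is odd for every x ∈ N(p_{d+1}).

module Submission where

open import Defs hiding (sym)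
open import Data.Bool using (Bool; true; false; T; _∧_)
open import Data.Bool.Properties using (∧-idem) renaming (_≟_ to _≟ᵇ_)
open import Data.Empty using (⊥)
open import Data.Fin using (Fin; zero; suc; _≟_)
open import Data.Fin.Properties using (suc-injective)
open import Data.List using (List; []; _∷_; _++_; map; concatMap; filter; length; tabulate; allFin)
open import Data.Maybe using (Maybe; just; nothing)
open import Data.Nat using (ℕ; zero; suc; _%_; parity)
import Data.Nat as ℕ
-- Beware: in Data.Parity, _+_ and _*_ are both infixl 7.
open import Data.Parity using (Parity; 0ℙ; 1ℙ; _+_; _*_; _⁻¹)
open import Data.Parity.Properties
  using (+-*-semiring; +-identityʳ; +-assoc; p+p⁻¹≡1ℙ; *-zeroʳ; *-identityʳ; *-distribˡ-+; +-homo-+)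
open import Data.Product using (Σ; _×_; _,_)
open import Data.Unit using (⊤)
open import Data.Vec using (Vec; []; _∷_; [_]; last)
open import Data.Vec.Functional using () renaming (_∷_ to _◂_)
open import Function using (_∘_; _⇔_; mk⇔; Equivalence)
open Equivalence using (to; from)
open import Relation.Binary.PropositionalEquality
  using (_≡_; refl; sym; trans; cong; cong₂; subst; subst₂; _≗_; module ≡-Reasoning)
open import Relation.Nullary using (¬_; Dec; yes; no; does; contradiction)
open import Relation.Nullary.Decidable using (T?; dec-false; dec-true; does-⇔; _×-dec_)

open import Algebra.Properties.Semiring.Sum +-*-semiring
  using (sum; sum-syntax; sum-cong-≗; ∑-distrib-+; sum-replicate-zero; *-distribʳ-sum)

-- Counting modulo 2

𝟙 : Bool → Parity
𝟙 true  = 1ℙ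
𝟙 false = 0ℙ

𝟙-∧ : ∀ b c → 𝟙 (b ∧ c) ≡ 𝟙 b * 𝟙 c
𝟙-∧ true  c = refl
𝟙-∧ false c = refl

𝟙-∧-* : ∀ b c x → 𝟙 (b ∧ c) * x ≡ 𝟙 b * (𝟙 c * x)
𝟙-∧-* true  c x = refl
𝟙-∧-* false c x = refl

𝟙-T : ∀ {b} → T b → 𝟙 b ≡ 1ℙ
𝟙-T {true} _ = refl

𝟙≡1ℙ⇒T : ∀ {b} → 𝟙 b ≡ 1ℙ → T b
𝟙≡1ℙ⇒T {true} _ = _

𝟙-¬T : ∀ {b} → ¬ T b → 𝟙 b ≡ 0ℙ
𝟙-¬T {true}  ¬t = contradiction _ ¬t
𝟙-¬T {false} _  = refl

even⇔parity : ∀ m → Even m ⇔ (parity m ≡ 0ℙ)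
even⇔parity zero          = mk⇔ (λ _ → refl) (λ _ → refl)
even⇔parity (suc zero)    = mk⇔ (λ ()) (λ ())
even⇔parity (suc (suc m)) = even⇔parity m

odd⇔parity : ∀ m → Odd m ⇔ (parity m ≡ 1ℙ)
odd⇔parity zero          = mk⇔ (λ ()) (λ ())
odd⇔parity (suc zero)    = mk⇔ (λ _ → refl) (λ _ → refl)
odd⇔parity (suc (suc m)) = odd⇔parity m

𝟙-odd : ∀ m → 𝟙 (does (m % 2 ℕ.≟ 1)) ≡ parity m
𝟙-odd zero          = refl
𝟙-odd (suc zero)    = refl
𝟙-odd (suc (suc m)) = 𝟙-odd m

∑ˡ : ∀ {A : Set} → List A → (A → Parity) → Parity
∑ˡ []       g = 0ℙ
∑ˡ (x ∷ xs) g = g x + ∑ˡ xs g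

module _ {A : Set} where

  ∑ˡ-cong : ∀ (xs : List A) {g h : A → Parity} → (∀ x → g x ≡ h x) → ∑ˡ xs g ≡ ∑ˡ xs h
  ∑ˡ-cong []       g≗h = refl
  ∑ˡ-cong (x ∷ xs) g≗h = cong₂ _+_ (g≗h x) (∑ˡ-cong xs g≗h)

  ∑ˡ-++ : ∀ (xs ys : List A) g → ∑ˡ (xs ++ ys) g ≡ ∑ˡ xs g + ∑ˡ ys g
  ∑ˡ-++ []       ys g = refl
  ∑ˡ-++ (x ∷ xs) ys g = trans (cong (g x +_) (∑ˡ-++ xs ys g)) (sym (+-assoc (g x) _ _))

  ∑ˡ-concatMap : ∀ {B : Set} (h : B → List A) (xs : List B) g →
                 ∑ˡ (concatMap h xs) g ≡ ∑ˡ xs (λ x → ∑ˡ (h x) g)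
  ∑ˡ-concatMap h []       g = refl
  ∑ˡ-concatMap h (x ∷ xs) g =
    trans (∑ˡ-++ (h x) (concatMap h xs) g) (cong (∑ˡ (h x) g +_) (∑ˡ-concatMap h xs g))

  ∑ˡ-map : ∀ {B : Set} (f : B → A) (xs : List B) g → ∑ˡ (map f xs) g ≡ ∑ˡ xs (g ∘ f)
  ∑ˡ-map f []       g = refl
  ∑ˡ-map f (x ∷ xs) g = cong (g (f x) +_) (∑ˡ-map f xs g)

  *-distribˡ-∑ˡ : ∀ c (xs : List A) g → c * ∑ˡ xs g ≡ ∑ˡ xs (λ x → c * g x)
  *-distribˡ-∑ˡ c []       g = *-zeroʳ c
  *-distribˡ-∑ˡ c (x ∷ xs) g = trans (*-distribˡ-+ c (g x) _) (cong (c * g x +_) (*-distribˡ-∑ˡ c xs g))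

  ∑ˡ-∑-comm : ∀ {k} (xs : List A) (h : Fin k → A → Parity) →
              ∑ˡ xs (λ x → ∑[ i < k ] h i x) ≡ ∑[ i < k ] ∑ˡ xs (h i)
  ∑ˡ-∑-comm {k} []       h = sym (sum-replicate-zero k)
  ∑ˡ-∑-comm     (x ∷ xs) h =
    trans (cong (sum (λ i → h i x) +_) (∑ˡ-∑-comm xs h)) (sym (∑-distrib-+ (λ i → h i x) _))

  parity-length-filter : ∀ {P : A → Set} (P? : ∀ x → Dec (P x)) xs →
                         parity (length (filter P? xs)) ≡ ∑ˡ xs (𝟙 ∘ does ∘ P?)
  parity-length-filter P? []       = refl
  parity-length-filter P? (x ∷ xs) with does (P? x)
  ... | false = parity-length-filter P? xs
  ... | true  = trans (+-homo-+ 1 (length (filter P? xs))) (cong (1ℙ +_) (parity-length-filter P? xs))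

∑ˡ-tabulate : ∀ {A : Set} {k} (f : Fin k → A) g → ∑ˡ (tabulate f) g ≡ ∑[ i < k ] g (f i)
∑ˡ-tabulate {k = zero}  f g = refl
∑ˡ-tabulate {k = suc k} f g = cong (g (f zero) +_) (∑ˡ-tabulate (f ∘ suc) g)

parity-countFin : ∀ {k} {P : Fin k → Set} (P? : ∀ i → Dec (P i)) →
                  parity (countFin P?) ≡ ∑[ i < k ] 𝟙 (does (P? i))
parity-countFin {k} P? =
  trans (parity-length-filter P? (allFin k)) (∑ˡ-tabulate {k = k} (λ i → i) (𝟙 ∘ does ∘ P?))

∑-supported : ∀ {k} (h : Fin k → Parity) c → (∀ i → ¬ i ≡ c → h i ≡ 0ℙ) → ∑[ i < k ] h i ≡ h c
∑-supported {suc k} h zero h≡0 = begin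
  h zero + ∑[ i < k ] h (suc i)   ≡⟨ cong (h zero +_) (sum-cong-≗ (λ i → h≡0 (suc i) λ ())) ⟩
  h zero + ∑[ i < k ] 0ℙ          ≡⟨ cong (h zero +_) (sum-replicate-zero k) ⟩
  h zero + 0ℙ                     ≡⟨ +-identityʳ (h zero) ⟩
  h zero                          ∎
  where open ≡-Reasoning
∑-supported {suc k} h (suc c) h≡0 =
  trans (cong (_+ ∑[ i < k ] h (suc i)) (h≡0 zero λ ()))
        (∑-supported (h ∘ suc) c (λ i i≢c → h≡0 (suc i) (i≢c ∘ suc-injective)))

-- allFuns extends functions by a cons local to Defs, which is only pointwise equal to _◂_.
∑ˡ-allFuns-suc : ∀ m k (g : (Fin (suc m) → Fin k) → Parity) → (∀ {σ τ} → σ ≗ τ → g σ ≡ g τ) →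
                 ∑ˡ (allFuns (suc m) k) g ≡ ∑ˡ (allFuns m k) (λ f → ∑[ a < k ] g (a ◂ f))
∑ˡ-allFuns-suc m k g g-resp =
  trans (∑ˡ-concatMap _ (allFuns m k) g) (∑ˡ-cong (allFuns m k) λ f →
    trans (∑ˡ-map _ (allFin k) g) (trans (∑ˡ-tabulate {k = k} (λ a → a) _)
      (sum-cong-≗ λ a → g-resp {τ = a ◂ f} λ { zero → refl ; (suc i) → refl })))

∑ˡ-allFuns-2+ : ∀ m k (g : (Fin (suc (suc m)) → Fin k) → Parity) → (∀ {σ τ} → σ ≗ τ → g σ ≡ g τ) →
                ∑ˡ (allFuns (suc (suc m)) k) g ≡
                ∑ˡ (allFuns m k) (λ f → ∑[ b < k ] ∑[ a < k ] g (a ◂ b ◂ f))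
∑ˡ-allFuns-2+ m k g g-resp = trans (∑ˡ-allFuns-suc (suc m) k g g-resp)
  (∑ˡ-allFuns-suc m k _ λ {f} {f′} f≗f′ → sum-cong-≗ λ a →
    g-resp {a ◂ f} {a ◂ f′} λ { zero → refl ; (suc i) → f≗f′ i })

-- Graphs and caterpillars

Adj-sym : ∀ (G : Graph) {u v} → Adj G u v → Adj G v u
Adj-sym G {u} {v} = subst T (Defs.sym G u v)

module _ {G : Graph} where

  _++ʷ_ : ∀ {u v w} → Walk G u v → Walk G v w → Walk G u w
  here       ++ʷ q = q
  step e p   ++ʷ q = step e (p ++ʷ q)

  reverseʷ : ∀ {u v} → Walk G u v → Walk G v u
  reverseʷ here       = here
  reverseʷ (step e p) = reverseʷ p ++ʷ step (Adj-sym G e) here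

  connected-viaRoot : ∀ r → (∀ v → Walk G v r) → Connected G
  connected-viaRoot r toRoot u v = toRoot u ++ʷ reverseʷ (toRoot v)

double : ℕ → ℕ
double zero    = zero
double (suc d) = suc (suc (double d))

catSize : ℕ → ℕ
catSize d = suc (suc (double d))

-- catGraph d has spine w₀, …, w_d, each wⱼ with a leg; vertex 0 is w₀, vertex 1 its leg, and
-- suc (suc i) is vertex i of catGraph (d - 1).
catAdj : ∀ d → Fin (catSize d) → Fin (catSize d) → Bool
catAdj d       zero          zero          = false
catAdj d       zero          (suc zero)    = true
catAdj (suc d) zero          (suc (suc j)) = does (j ≟ zero)
catAdj d       (suc zero)    zero          = true
catAdj d       (suc zero)    (suc _)       = false
catAdj (suc d) (suc (suc i)) zero          = does (i ≟ zero)
catAdj (suc d) (suc (suc i)) (suc zero)    = false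
catAdj (suc d) (suc (suc i)) (suc (suc j)) = catAdj d i j

catAdj-sym : ∀ d u v → catAdj d u v ≡ catAdj d v u
catAdj-sym d       zero          zero          = refl
catAdj-sym d       zero          (suc zero)    = refl
catAdj-sym (suc d) zero          (suc (suc j)) = refl
catAdj-sym d       (suc zero)    zero          = refl
catAdj-sym d       (suc zero)    (suc zero)    = refl
catAdj-sym (suc d) (suc zero)    (suc (suc j)) = refl
catAdj-sym (suc d) (suc (suc i)) zero          = refl
catAdj-sym (suc d) (suc (suc i)) (suc zero)    = refl
catAdj-sym (suc d) (suc (suc i)) (suc (suc j)) = catAdj-sym d i j

catAdj-irrefl : ∀ d v → catAdj d v v ≡ false
catAdj-irrefl d       zero          = refl
catAdj-irrefl d       (suc zero)    = refl
catAdj-irrefl (suc d) (suc (suc i)) = catAdj-irrefl d i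

catGraph : ℕ → Graph
catGraph d = record { n = catSize d ; adj = catAdj d ; sym = catAdj-sym d ; irrefl = catAdj-irrefl d }

spineEnd : ∀ d → Fin (catSize d)
spineEnd zero    = zero
spineEnd (suc d) = suc (suc (spineEnd d))

catGraph-connected : ∀ d → Connected (catGraph d)
catGraph-connected d = connected-viaRoot zero (toRoot d)
  where
  shift : ∀ {d u v} → Walk (catGraph d) u v → Walk (catGraph (suc d)) (suc (suc u)) (suc (suc v))
  shift here       = here
  shift (step e p) = step e (shift p)
  toRoot : ∀ d v → Walk (catGraph d) v zero
  toRoot d       zero          = here
  toRoot d       (suc zero)    = step _ here
  toRoot (suc d) (suc (suc i)) = shift (toRoot d i) ++ʷ step _ here

module _ (H : Graph) where

  private
    V = Fin (n H)
    k = n H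

  -- Homomorphisms from a caterpillar

  δ : V → V → Parity
  δ a b = 𝟙 (does (a ≟ b))

  δ-refl : ∀ a → δ a a ≡ 1ℙ
  δ-refl a = cong 𝟙 (dec-true (a ≟ a) refl)

  δ-≢ : ∀ {a b} → ¬ a ≡ b → δ a b ≡ 0ℙ
  δ-≢ {a} {b} a≢b = cong 𝟙 (dec-false (a ≟ b) a≢b)

  legLabel : ∀ {d} → Vec V (suc d) → Fin (catSize d) → Maybe V
  legLabel         ps       zero          = nothing
  legLabel         (p ∷ _)  (suc zero)    = just p
  legLabel {suc d} (_ ∷ ps) (suc (suc i)) = legLabel ps i

  caterpillar : ∀ {d} → Vec V (suc d) → PLGraph H
  caterpillar {d} ps = record { G = catGraph d ; τ = legLabel ps }

  IsHom-resp : ∀ (J : PLGraph H) {σ τ} → σ ≗ τ → IsHom J σ → IsHom J τ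
  IsHom-resp J σ≗τ (edges , pins) =
    (λ u v uv → subst₂ (λ a b → Adj H a b) (σ≗τ u) (σ≗τ v) (edges u v uv)) ,
    (λ v a τv≡a → trans (sym (σ≗τ v)) (pins v a τv≡a))

  leg-pinned : ∀ {d} p (ps : Vec V d) σ → IsHom (caterpillar (p ∷ ps)) σ → σ (suc zero) ≡ p
  leg-pinned p ps σ (_ , pins) = pins (suc zero) p refl

  isHom-[] : ∀ p a (f : Fin 0 → V) → IsHom (caterpillar [ p ]) (a ◂ p ◂ f) ⇔ Adj H a p
  isHom-[] p a f = mk⇔ (λ (edges , _) → edges zero (suc zero) _) λ a~p →
    (λ { zero (suc zero) _ → a~p ; (suc zero) zero _ → Adj-sym H a~p }) ,
    (λ { (suc zero) b refl → refl })

  isHom-∷ : ∀ {d} p q (ps : Vec V d) a (f : Fin (catSize d) → V) →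
            IsHom (caterpillar (p ∷ q ∷ ps)) (a ◂ p ◂ f) ⇔
            (Adj H a p × Adj H a (f zero) × IsHom (caterpillar (q ∷ ps)) f)
  isHom-∷ p q ps a f = mk⇔
    (λ (edges , pins) → edges zero (suc zero) _ , edges zero (suc (suc zero)) _ ,
                        (λ u v → edges (suc (suc u)) (suc (suc v))) , (λ v → pins (suc (suc v))))
    (λ (a~p , a~f₀ , edges , pins) → edgesᶜ a~p a~f₀ edges , pinsᶜ pins)
    where
    σ = a ◂ p ◂ f
    edgesᶜ : Adj H a p → Adj H a (f zero) → (∀ u v → Adj (catGraph _) u v → Adj H (f u) (f v)) →
             ∀ u v → Adj (G (caterpillar (p ∷ q ∷ ps))) u v → Adj H (σ u) (σ v)
    edgesᶜ a~p a~f₀ edges zero             (suc zero)       _  = a~p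
    edgesᶜ a~p a~f₀ edges zero             (suc (suc zero)) _  = a~f₀
    edgesᶜ a~p a~f₀ edges (suc zero)       zero             _  = Adj-sym H a~p
    edgesᶜ a~p a~f₀ edges (suc (suc zero)) zero             _  = Adj-sym H a~f₀
    edgesᶜ a~p a~f₀ edges (suc (suc u))    (suc (suc v))    uv = edges u v uv
    pinsᶜ : (∀ v b → legLabel (q ∷ ps) v ≡ just b → f v ≡ b) →
            ∀ v b → legLabel (p ∷ q ∷ ps) v ≡ just b → σ v ≡ b
    pinsᶜ pins (suc zero)    b refl = refl
    pinsᶜ pins (suc (suc v)) b eq   = pins v b eq

  homSummand : ∀ (J : PLGraph H) (y z : Fin (n (G J))) (o x : V) → (Fin (n (G J)) → V) → Parity
  homSummand J y z o x σ = 𝟙 (does (isHom? J σ)) * (δ (σ y) o * δ (σ z) x)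

  homSummand-resp : ∀ J y z o x {σ τ} → σ ≗ τ → homSummand J y z o x σ ≡ homSummand J y z o x τ
  homSummand-resp J y z o x {σ} {τ} σ≗τ =
    cong₂ (λ h e → 𝟙 h * e)
      (does-⇔ (mk⇔ (IsHom-resp J σ≗τ) (IsHom-resp J (sym ∘ σ≗τ))) (isHom? J σ) (isHom? J τ))
      (cong₂ (λ a b → δ a o * δ b x) (σ≗τ y) (σ≗τ z))

  parity-homCount2 : ∀ J y z o x →
                     parity (homCount2 J y z o x) ≡ ∑ˡ (allFuns (n (G J)) k) (homSummand J y z o x)
  parity-homCount2 J y z o x = trans (parity-length-filter _ Fs) (∑ˡ-cong Fs λ σ →
    trans (𝟙-∧ (does (isHom? J σ)) _) (cong (𝟙 (does (isHom? J σ)) *_) (𝟙-∧ (does (σ y ≟ o)) _)))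
    where Fs = allFuns (n (G J)) k

  ∑∑-pinned : ∀ (h : V → V → Bool) (L : V → Parity) o p → (∀ a b → ¬ b ≡ p → h a b ≡ false) →
              ∑[ b < k ] ∑[ a < k ] (𝟙 (h a b) * (δ a o * L a)) ≡ 𝟙 (h o p) * L o
  ∑∑-pinned h L o p off-p = trans (sum-cong-≗ λ b → ∑-supported _ o (λ a a≢o → atOther b a a≢o))
    (trans (∑-supported _ p (λ b b≢p → cong (λ t → 𝟙 t * _) (off-p o b b≢p)))
           (cong (λ t → 𝟙 (h o p) * (t * L o)) (δ-refl o)))
    where
    atOther : ∀ b a → ¬ a ≡ o → 𝟙 (h a b) * (δ a o * L a) ≡ 0ℙ
    atOther b a a≢o = trans (cong (λ t → 𝟙 (h a b) * (t * L a)) (δ-≢ a≢o)) (*-zeroʳ _)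

  catParity : ∀ {d} → Vec V (suc d) → V → V → Parity
  catParity {d} ps o x = parity (homCount2 (caterpillar ps) zero (spineEnd d) o x)

  catParity-[] : ∀ p o x → catParity [ p ] o x ≡ 𝟙 (adj H o p) * δ o x
  catParity-[] p o x = begin
    catParity [ p ] o x
      ≡⟨ parity-homCount2 K zero zero o x ⟩
    ∑ˡ (allFuns 2 k) (homSummand K zero zero o x)
      ≡⟨ ∑ˡ-allFuns-2+ 0 k _ (homSummand-resp K zero zero o x) ⟩
    (∑[ b < k ] ∑[ a < k ] homSummand K zero zero o x (a ◂ b ◂ λ ())) + 0ℙ
      ≡⟨ +-identityʳ _ ⟩
    ∑[ b < k ] ∑[ a < k ] homSummand K zero zero o x (a ◂ b ◂ λ ())
      ≡⟨ ∑∑-pinned (λ a b → does (isHom? K (a ◂ b ◂ λ ()))) (λ a → δ a x) o p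
                   (λ a b b≢p → dec-false (isHom? K _) (b≢p ∘ leg-pinned p [] (a ◂ b ◂ λ ()))) ⟩
    𝟙 (does (isHom? K (o ◂ p ◂ λ ()))) * δ o x
      ≡⟨ cong (λ h → 𝟙 h * δ o x) (does-⇔ (isHom-[] p o (λ ())) (isHom? K _) (T? (adj H o p))) ⟩
    𝟙 (adj H o p) * δ o x
      ∎
    where
    open ≡-Reasoning
    K = caterpillar [ p ]

  homSummand-peel : ∀ {d} p q (ps : Vec V d) o x (f : Fin (catSize d) → V) →
    ∑[ b < k ] ∑[ a < k ] homSummand (caterpillar (p ∷ q ∷ ps)) zero (spineEnd (suc d)) o x (a ◂ b ◂ f) ≡
    𝟙 (adj H o p) * (𝟙 (adj H o (f zero)) *
                     (𝟙 (does (isHom? (caterpillar (q ∷ ps)) f)) * δ (f (spineEnd d)) x))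
  homSummand-peel {d} p q ps o x f = begin
    ∑[ b < k ] ∑[ a < k ] homSummand K zero (spineEnd (suc d)) o x (a ◂ b ◂ f)
      ≡⟨ ∑∑-pinned (λ a b → does (isHom? K (a ◂ b ◂ f))) (λ _ → L) o p
                   (λ a b b≢p → dec-false (isHom? K _) (b≢p ∘ leg-pinned p (q ∷ ps) (a ◂ b ◂ f))) ⟩
    𝟙 (does (isHom? K (o ◂ p ◂ f))) * L
      ≡⟨ cong (λ h → 𝟙 h * L) (does-⇔ (isHom-∷ p q ps o f) (isHom? K _)
                                      (T? (adj H o p) ×-dec T? (adj H o (f zero)) ×-dec isHom? K′ f)) ⟩
    𝟙 (adj H o p ∧ adj H o (f zero) ∧ does (isHom? K′ f)) * L
      ≡⟨ 𝟙-∧-* (adj H o p) _ L ⟩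
    𝟙 (adj H o p) * (𝟙 (adj H o (f zero) ∧ does (isHom? K′ f)) * L)
      ≡⟨ cong (𝟙 (adj H o p) *_) (𝟙-∧-* (adj H o (f zero)) _ L) ⟩
    𝟙 (adj H o p) * (𝟙 (adj H o (f zero)) * (𝟙 (does (isHom? K′ f)) * L))
      ∎
    where
    open ≡-Reasoning
    K  = caterpillar (p ∷ q ∷ ps)
    K′ = caterpillar (q ∷ ps)
    L  = δ (f (spineEnd d)) x

  ∑-adj-catParity : ∀ {d} (ps : Vec V (suc d)) o x →
    ∑[ a < k ] (𝟙 (adj H o a) * catParity ps a x) ≡
    ∑ˡ (allFuns (catSize d) k)
       (λ f → 𝟙 (adj H o (f zero)) * (𝟙 (does (isHom? (caterpillar ps) f)) * δ (f (spineEnd d)) x))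
  ∑-adj-catParity {d} ps o x = begin
    ∑[ a < k ] (𝟙 (adj H o a) * catParity ps a x)
      ≡⟨ sum-cong-≗ (λ a → cong (𝟙 (adj H o a) *_) (parity-homCount2 K zero (spineEnd d) a x)) ⟩
    ∑[ a < k ] (𝟙 (adj H o a) * ∑ˡ Fs (hs a))
      ≡⟨ sum-cong-≗ (λ a → *-distribˡ-∑ˡ (𝟙 (adj H o a)) Fs (hs a)) ⟩
    ∑[ a < k ] ∑ˡ Fs (λ f → 𝟙 (adj H o a) * hs a f)
      ≡⟨ ∑ˡ-∑-comm Fs (λ a f → 𝟙 (adj H o a) * hs a f) ⟨
    ∑ˡ Fs (λ f → ∑[ a < k ] (𝟙 (adj H o a) * hs a f))
      ≡⟨ ∑ˡ-cong Fs (λ f → ∑-supported _ (f zero) (offHead f)) ⟩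
    ∑ˡ Fs (λ f → 𝟙 (adj H o (f zero)) * hs (f zero) f)
      ≡⟨ ∑ˡ-cong Fs (λ f → cong (λ t → 𝟙 (adj H o (f zero)) * (𝟙 (does (isHom? K f)) * (t * L f)))
                                (δ-refl (f zero))) ⟩
    ∑ˡ Fs (λ f → 𝟙 (adj H o (f zero)) * (𝟙 (does (isHom? K f)) * L f))
      ∎
    where
    open ≡-Reasoning
    K  = caterpillar ps
    Fs = allFuns (catSize d) k
    hs : V → (Fin (catSize d) → V) → Parity
    hs a = homSummand K zero (spineEnd d) a x
    L : (Fin (catSize d) → V) → Parity
    L f = δ (f (spineEnd d)) x
    offHead : ∀ f a → ¬ a ≡ f zero → 𝟙 (adj H o a) * hs a f ≡ 0ℙ
    offHead f a a≢f₀ rewrite δ-≢ (a≢f₀ ∘ sym) | *-zeroʳ (𝟙 (does (isHom? K f))) = *-zeroʳ _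

  catParity-∷ : ∀ {d} p q (ps : Vec V d) o x →
                catParity (p ∷ q ∷ ps) o x ≡
                𝟙 (adj H o p) * ∑[ a < k ] (𝟙 (adj H o a) * catParity (q ∷ ps) a x)
  catParity-∷ {d} p q ps o x = begin
    catParity (p ∷ q ∷ ps) o x
      ≡⟨ parity-homCount2 K zero end o x ⟩
    ∑ˡ (allFuns (catSize (suc d)) k) (homSummand K zero end o x)
      ≡⟨ ∑ˡ-allFuns-2+ (catSize d) k _ (homSummand-resp K zero end o x) ⟩
    ∑ˡ Fs (λ f → ∑[ b < k ] ∑[ a < k ] homSummand K zero end o x (a ◂ b ◂ f))
      ≡⟨ ∑ˡ-cong Fs (homSummand-peel p q ps o x) ⟩
    ∑ˡ Fs (λ f → 𝟙 (adj H o p) * W f)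
      ≡⟨ *-distribˡ-∑ˡ (𝟙 (adj H o p)) Fs W ⟨
    𝟙 (adj H o p) * ∑ˡ Fs W
      ≡⟨ cong (𝟙 (adj H o p) *_) (∑-adj-catParity (q ∷ ps) o x) ⟨
    𝟙 (adj H o p) * ∑[ a < k ] (𝟙 (adj H o a) * catParity (q ∷ ps) a x)
      ∎
    where
    open ≡-Reasoning
    K   = caterpillar (p ∷ q ∷ ps)
    end = spineEnd (suc d)
    Fs  = allFuns (catSize d) k
    W : (Fin (catSize d) → V) → Parity
    W f = 𝟙 (adj H o (f zero)) * (𝟙 (does (isHom? (caterpillar (q ∷ ps)) f)) * δ (f (spineEnd d)) x)

  catParity-nonAdjacent : ∀ {d} p (ps : Vec V d) {o} x → ¬ Adj H o p →
                          catParity (p ∷ ps) o x ≡ 0ℙ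
  catParity-nonAdjacent p []       {o} x o≁p rewrite catParity-[] p o x | 𝟙-¬T o≁p = refl
  catParity-nonAdjacent p (q ∷ ps) {o} x o≁p rewrite catParity-∷ p q ps o x | 𝟙-¬T o≁p = refl

  Adj⇒≢ : ∀ {a b} → Adj H a b → ¬ a ≡ b
  Adj⇒≢ {a} a~a refl = subst T (irrefl H a) a~a

  noSquare : SquareFree H → ∀ {a b c d} → Adj H a b → Adj H b c → Adj H c d → Adj H d a →
             ¬ a ≡ c → ¬ b ≡ d → ⊥
  noSquare sf a~b b~c c~d d~a a≢c b≢d =
    sf _ _ _ _ (Adj⇒≢ a~b , a≢c , Adj⇒≢ (Adj-sym H d~a) , Adj⇒≢ b~c , b≢d , Adj⇒≢ c~d ,
                a~b , b~c , c~d , d~a)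

  catParity-shift : SquareFree H → ∀ {d} {o p q} (ps : Vec V d) x →
                    Adj H o p → ¬ o ≡ q → Adj H p q →
                    catParity (p ∷ q ∷ ps) o x ≡ catParity (q ∷ ps) p x
  catParity-shift sf {o = o} {p} {q} ps x o~p o≢q p~q = begin
    catParity (p ∷ q ∷ ps) o x
      ≡⟨ catParity-∷ p q ps o x ⟩
    𝟙 (adj H o p) * ∑[ a < k ] (𝟙 (adj H o a) * catParity (q ∷ ps) a x)
      ≡⟨ cong (_* _) (𝟙-T o~p) ⟩
    ∑[ a < k ] (𝟙 (adj H o a) * catParity (q ∷ ps) a x)
      ≡⟨ ∑-supported _ p offP ⟩
    𝟙 (adj H o p) * catParity (q ∷ ps) p x
      ≡⟨ cong (_* _) (𝟙-T o~p) ⟩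
    catParity (q ∷ ps) p x
      ∎
    where
    open ≡-Reasoning
    offP : ∀ a → ¬ a ≡ p → 𝟙 (adj H o a) * catParity (q ∷ ps) a x ≡ 0ℙ
    offP a a≢p with T? (adj H o a)
    ... | no  o≁a = cong (_* _) (𝟙-¬T o≁a)
    ... | yes o~a = trans (cong (𝟙 (adj H o a) *_) (catParity-nonAdjacent q ps x a≁q)) (*-zeroʳ _)
      where
      a≁q : ¬ Adj H a q
      a≁q a~q = noSquare sf o~a a~q (Adj-sym H p~q) (Adj-sym H o~p) o≢q a≢p

  data NBPath : ∀ {d} → Vec V (suc (suc d)) → Set where
    edge   : ∀ {a b} → Adj H a b → NBPath (a ∷ b ∷ [])
    extend : ∀ {d a b c} {r : Vec V d} → Adj H a b → ¬ a ≡ c → NBPath (b ∷ c ∷ r) →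
             NBPath (a ∷ b ∷ c ∷ r)

  NBPath-head : ∀ {d a b} {r : Vec V d} → NBPath (a ∷ b ∷ r) → Adj H a b
  NBPath-head (edge a~b)       = a~b
  NBPath-head (extend a~b _ _) = a~b

  penultimate : ∀ {d} → Vec V (suc (suc d)) → V
  penultimate (a ∷ _ ∷ [])    = a
  penultimate (_ ∷ b ∷ c ∷ r) = penultimate (b ∷ c ∷ r)

  NBPath-last : ∀ {d} {ps : Vec V (suc (suc d))} → NBPath ps → Adj H (penultimate ps) (last ps)
  NBPath-last (edge a~b)        = a~b
  NBPath-last (extend _ _ path) = NBPath-last path

  OddInterior : ∀ {d} → Vec V (suc (suc d)) → Set
  OddInterior (_ ∷ _ ∷ [])    = ⊤
  OddInterior (_ ∷ b ∷ c ∷ r) = parity (degree H b) ≡ 1ℙ × OddInterior (b ∷ c ∷ r)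

  catParity-nonBacktracking : SquareFree H → ∀ {d} o (ps : Vec V (suc d)) → NBPath (o ∷ ps) →
                              ∀ x → catParity ps o x ≡ δ (penultimate (o ∷ ps)) x
  catParity-nonBacktracking sf o (p ∷ [])     (edge o~p) x =
    trans (catParity-[] p o x) (cong (_* δ o x) (𝟙-T o~p))
  catParity-nonBacktracking sf o (p ∷ q ∷ ps) (extend o~p o≢q path) x =
    trans (catParity-shift sf ps x o~p o≢q (NBPath-head path))
          (catParity-nonBacktracking sf p (q ∷ ps) path x)

  parity-degree : ∀ v → parity (degree H v) ≡ ∑[ a < k ] 𝟙 (adj H v a)
  parity-degree v = trans (parity-countFin (λ a → adj H v a ≟ᵇ true))
                          (sum-cong-≗ λ a → cong 𝟙 (does-≟true (adj H v a)))
    where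
    does-≟true : ∀ b → does (b ≟ᵇ true) ≡ b
    does-≟true true  = refl
    does-≟true false = refl

  catParity-backtrack : SquareFree H → ∀ {d} p q (r : Vec V d) →
                        NBPath (p ∷ q ∷ r) → OddInterior (p ∷ q ∷ r) →
                        ∀ x → Adj H x (last (p ∷ q ∷ r)) → catParity (p ∷ q ∷ r) q x ≡ 1ℙ
  catParity-backtrack sf p q [] (edge p~q) _ x x~q = begin
    catParity (p ∷ q ∷ []) q x
      ≡⟨ catParity-∷ p q [] q x ⟩
    𝟙 (adj H q p) * ∑[ a < k ] (𝟙 (adj H q a) * catParity [ q ] a x)
      ≡⟨ cong (_* _) (𝟙-T (Adj-sym H p~q)) ⟩
    ∑[ a < k ] (𝟙 (adj H q a) * catParity [ q ] a x)
      ≡⟨ ∑-supported _ x offX ⟩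
    𝟙 (adj H q x) * catParity [ q ] x x
      ≡⟨ cong₂ _*_ (𝟙-T (Adj-sym H x~q)) (catParity-[] q x x) ⟩
    𝟙 (adj H x q) * δ x x
      ≡⟨ cong₂ _*_ (𝟙-T x~q) (δ-refl x) ⟩
    1ℙ
      ∎
    where
    open ≡-Reasoning
    offX : ∀ a → ¬ a ≡ x → 𝟙 (adj H q a) * catParity [ q ] a x ≡ 0ℙ
    offX a a≢x rewrite catParity-[] q a x | δ-≢ a≢x | *-zeroʳ (𝟙 (adj H a q)) = *-zeroʳ _
  catParity-backtrack sf p q (c ∷ r) (extend p~q _ path) (odd-q , oddRest) x x~last = begin
    catParity (p ∷ q ∷ c ∷ r) q x
      ≡⟨ catParity-∷ p q (c ∷ r) q x ⟩
    𝟙 (adj H q p) * ∑[ a < k ] (𝟙 (adj H q a) * catParity (q ∷ c ∷ r) a x)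
      ≡⟨ cong (_* _) (𝟙-T (Adj-sym H p~q)) ⟩
    ∑[ a < k ] (𝟙 (adj H q a) * catParity (q ∷ c ∷ r) a x)
      ≡⟨ sum-cong-≗ split ⟩
    ∑[ a < k ] ((𝟙 (adj H q a) * ε) + (δ a c * ε ⁻¹))
      ≡⟨ ∑-distrib-+ (λ a → 𝟙 (adj H q a) * ε) (λ a → δ a c * ε ⁻¹) ⟩
    (∑[ a < k ] (𝟙 (adj H q a) * ε)) + (∑[ a < k ] (δ a c * ε ⁻¹))
      ≡⟨ cong₂ _+_ (sym (*-distribʳ-sum ε (λ a → 𝟙 (adj H q a))))
                   (∑-supported _ c (λ a a≢c → cong (_* ε ⁻¹) (δ-≢ a≢c))) ⟩
    ((∑[ a < k ] 𝟙 (adj H q a)) * ε) + (δ c c * ε ⁻¹)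
      ≡⟨ cong₂ (λ s t → (s * ε) + (t * ε ⁻¹)) (trans (sym (parity-degree q)) odd-q) (δ-refl c) ⟩
    ε + ε ⁻¹
      ≡⟨ p+p⁻¹≡1ℙ ε ⟩
    1ℙ
      ∎
    where
    open ≡-Reasoning
    ε = δ (penultimate (q ∷ c ∷ r)) x
    split : ∀ a → 𝟙 (adj H q a) * catParity (q ∷ c ∷ r) a x ≡ (𝟙 (adj H q a) * ε) + (δ a c * ε ⁻¹)
    split a with a ≟ c
    ... | yes refl rewrite 𝟙-T (NBPath-head path)
                         | catParity-backtrack sf q a r path oddRest x x~last = sym (p+p⁻¹≡1ℙ ε)
    ... | no a≢c with T? (adj H q a)
    ...   | yes q~a rewrite 𝟙-T q~a
                          | catParity-nonBacktracking sf a (q ∷ c ∷ r) (extend (Adj-sym H q~a) a≢c path) x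
                          = sym (+-identityʳ ε)
    ...   | no q≁a rewrite 𝟙-¬T q≁a = refl

  parity-homCount1 : ∀ (J : PLGraph H) y a → parity (homCount1 J y a) ≡ parity (homCount2 J y y a a)
  parity-homCount1 J y a =
    trans (parity-length-filter (λ σ → isHom? J σ ×-dec σ y ≟ a) Fs) (trans
      (∑ˡ-cong Fs λ σ → cong (λ b → 𝟙 (does (isHom? J σ) ∧ b)) (sym (∧-idem (does (σ y ≟ a)))))
      (sym (parity-length-filter (λ σ → isHom? J σ ×-dec σ y ≟ a ×-dec σ y ≟ a) Fs)))
    where Fs = allFuns (n (G J)) k

  parity-leg : ∀ p a → parity (homCount1 (caterpillar [ p ]) zero a) ≡ 𝟙 (adj H a p)
  parity-leg p a = begin
    parity (homCount1 (caterpillar [ p ]) zero a) ≡⟨ parity-homCount1 (caterpillar [ p ]) zero a ⟩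
    catParity [ p ] a a                          ≡⟨ catParity-[] p a a ⟩
    𝟙 (adj H a p) * δ a a                        ≡⟨ cong (𝟙 (adj H a p) *_) (δ-refl a) ⟩
    𝟙 (adj H a p) * 1ℙ                           ≡⟨ *-identityʳ _ ⟩
    𝟙 (adj H a p)                                ∎
    where open ≡-Reasoning

  Ω-leg : ∀ p a → Ω (caterpillar [ p ]) zero a ⇔ Adj H a p
  Ω-leg p a = mk⇔ (λ odd → 𝟙≡1ℙ⇒T (trans (sym (parity-leg p a)) (to (odd⇔parity m) odd)))
                  (λ a~p → from (odd⇔parity m) (trans (parity-leg p a) (𝟙-T a~p)))
    where m = homCount1 (caterpillar [ p ]) zero a

  parity-ΩSize-leg : ∀ p → parity (ΩSize (caterpillar [ p ]) zero) ≡ parity (degree H p)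
  parity-ΩSize-leg p = begin
    parity (ΩSize (caterpillar [ p ]) zero)   ≡⟨ parity-countFin (λ a → hc a % 2 ℕ.≟ 1) ⟩
    ∑[ a < k ] 𝟙 (does (hc a % 2 ℕ.≟ 1))     ≡⟨ sum-cong-≗ (λ a → trans (𝟙-odd (hc a)) (parity-leg p a)) ⟩
    ∑[ a < k ] 𝟙 (adj H a p)                 ≡⟨ sum-cong-≗ (λ a → cong 𝟙 (Defs.sym H a p)) ⟩
    ∑[ a < k ] 𝟙 (adj H p a)                 ≡⟨ parity-degree p ⟨
    parity (degree H p)                       ∎
    where
    open ≡-Reasoning
    hc = homCount1 (caterpillar [ p ]) zero

  caterpillar-pinned : ∀ {d} p (ps : Vec V d) → HasPinned (caterpillar (p ∷ ps))
  caterpillar-pinned p ps = suc zero , p , refl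

  -- Non-backtracking walks and the gadget

  mutual
    data NBWalk : V → V → Set where
      []   : ∀ {u} → NBWalk u u
      step : ∀ {u v w} → Adj H u v → (p : NBWalk v w) → ¬ StepsTo u p → NBWalk u w

    StepsTo : ∀ {v w} → V → NBWalk v w → Set
    StepsTo u []                   = ⊥
    StepsTo u (step {v = c} _ _ _) = c ≡ u

  prepend : ∀ {u v w} → Adj H u v → NBWalk v w → NBWalk u w
  prepend u~v []                        = step u~v [] (λ ())
  prepend {u} u~v (step {v = c} v~c p c↛) with c ≟ u
  ... | yes refl = p
  ... | no  c≢u  = step u~v (step v~c p c↛) c≢u

  nonBacktracking : ∀ {u v} → Walk H u v → NBWalk u v
  nonBacktracking here       = []
  nonBacktracking (step e p) = prepend e (nonBacktracking p)

  record GadgetPath (a b : V) : Set where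
    constructor gadgetPath
    field
      {len}       : ℕ
      rest        : Vec V len
      nb          : NBPath (a ∷ b ∷ rest)
      oddInterior : OddInterior (a ∷ b ∷ rest)
      evenEnd     : parity (degree H (last (a ∷ b ∷ rest))) ≡ 0ℙ

  oddPrefix : ∀ {a b t} → Adj H a b → (p : NBWalk b t) → ¬ StepsTo a p →
              parity (degree H t) ≡ 0ℙ → GadgetPath a b
  oddPrefix a~b []                 _  even-t = gadgetPath [] (edge a~b) _ even-t
  oddPrefix {b = b} a~b (step b~c p c↛b) c↛a even-t with parity (degree H b) in eq
  ... | 0ℙ = gadgetPath [] (edge a~b) _ eq
  ... | 1ℙ with oddPrefix b~c p c↛b even-t
  ...   | gadgetPath r path odd even = gadgetPath (_ ∷ r) (extend a~b (c↛a ∘ sym) path) (eq , odd) even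

  PinnedHardnessGadget : Set
  PinnedHardnessGadget =
    Σ V λ i → Σ V λ s →
    Σ (PLGraph H) λ J₁ → Σ (Fin (n (G J₁))) λ y →
    Σ (PLGraph H) λ J₂ → Σ (Fin (n (G J₂))) λ z →
    Σ (PLGraph H) λ J₃ → Σ (Fin (n (G J₃))) λ y′ → Σ (Fin (n (G J₃))) λ z′ →
      IsHardnessGadget H i s J₁ y J₂ z J₃ y′ z′ ×
      HasPinned J₁ × HasPinned J₂ × HasPinned J₃

  pinnedHardnessGadget : SquareFree H → ∀ {p q} → parity (degree H p) ≡ 0ℙ → GadgetPath p q →
                         PinnedHardnessGadget
  pinnedHardnessGadget sf {p} {q} even-p (gadgetPath {d} r path odd even-l) =
    q , s , J₁ , zero , J₂ , zero , J₃ , zero , spineEnd (suc d) ,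
    ( catGraph-connected 0 , catGraph-connected 0 , catGraph-connected (suc d)
    , (evenΩ p even-p , from (Ω-leg p q) (Adj-sym H (NBPath-head path)))
    , (evenΩ l even-l , from (Ω-leg l s) (NBPath-last path))
    , (λ o x o∈ o≢q x∈ x≢s → from (even⇔parity (count o x))
                                  (trans (catParity-fromΩ₁ o∈ o≢q x) (δ-≢ (x≢s ∘ sym))))
    , from (odd⇔parity (count q s)) (catParity-backtrack sf p q r path odd s (NBPath-last path))
    , (λ o o∈ o≢q → from (odd⇔parity (count o s)) (trans (catParity-fromΩ₁ o∈ o≢q s) (δ-refl s)))
    , (λ x x∈ _ → from (odd⇔parity (count q x))
                       (catParity-backtrack sf p q r path odd x (to (Ω-leg l x) x∈))) )
    , caterpillar-pinned p [] , caterpillar-pinned l [] , caterpillar-pinned p (q ∷ r)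
    where
    ps = p ∷ q ∷ r
    l  = last ps
    s  = penultimate ps
    J₁ = caterpillar [ p ]
    J₂ = caterpillar [ l ]
    J₃ = caterpillar ps

    count : V → V → ℕ
    count = homCount2 J₃ zero (spineEnd (suc d))

    evenΩ : ∀ v → parity (degree H v) ≡ 0ℙ → Even (ΩSize (caterpillar [ v ]) zero)
    evenΩ v even-v =
      from (even⇔parity (ΩSize (caterpillar [ v ]) zero)) (trans (parity-ΩSize-leg v) even-v)

    catParity-fromΩ₁ : ∀ {o} → Ω J₁ zero o → ¬ o ≡ q → ∀ x → catParity ps o x ≡ δ s x
    catParity-fromΩ₁ {o} o∈ o≢q =
      catParity-nonBacktracking sf o ps (extend (to (Ω-leg p o) o∈) o≢q path)

lemma5p3 : (H : Graph) → Connected H → SquareFree H → TwoEvenDegree H →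
    Σ (Fin (n H)) λ i → Σ (Fin (n H)) λ s →
    Σ (PLGraph H) λ J₁ → Σ (Fin (n (G J₁))) λ y →
    Σ (PLGraph H) λ J₂ → Σ (Fin (n (G J₂))) λ z →
    Σ (PLGraph H) λ J₃ → Σ (Fin (n (G J₃))) λ y' → Σ (Fin (n (G J₃))) λ z' →
    IsHardnessGadget H i s J₁ y J₂ z J₃ y' z' ×
    HasPinned J₁ × HasPinned J₂ × HasPinned J₃
lemma5p3 H connected sf (u , v , u≢v , even-u , even-v) with nonBacktracking H (connected u v)
... | []           = contradiction refl u≢v
... | step e p p↛u =
  pinnedHardnessGadget H sf (to (even⇔parity (degree H u)) even-u)
                             (oddPrefix H e p p↛u (to (even⇔parity (degree H v)) even-v))
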